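{- Let $n\ge 2$ and let $D=(V,A)$ be a strict digraph on $n$ vertices without isolated vertices. Let $\varphi$ be a real function on $\{1,\dots,n-1\}^2$ with $\varphi_{ij}=\varphi_{ji}$, where $\varphi_{ij}=\varphi(i,j)$, and let $I(D)=\frac12\sum_{uv\in A}\varphi(d_u^+,d_v^-)$. Put $M_{ij}=\frac{n-1}{2}\left(\frac1i+\frac1j\right)\varphi_{n-1,n-1}$ and $S_2=\{(i,j)\mid 1\le i\le j\le n-1\}\setminus\{(n-1,n-1)\}$. Then: (i) If $\varphi_{ij}>M_{ij}$ for all $(i,j)\in S_2$, then $I(D)\ge \frac14 n(n-1)\varphi_{n-1,n-1}$, with equality if and only if $n_0=n$ and $p_{ij}=0$ for all $(i,j)\in S_2$, i.e., if and only if $D=\vec K_2$. (ii) If $\varphi_{ij}<M_{ij}$ for all $(i,j)\in S_2$, then $I(D)\le \frac12 n(n-1)\varphi_{n-1,n-1}$, with equality if and only if $n_0=0$ and $p_{ij}=0$ for all $(i,j)\in S_2$, i.e., if and only if $D$ is the digraph obtained from the complete graph $K_n$ by replacing each edge with a pair of symmetric arcs.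
   Context: A digraph $D=(V,A)$ is strict: it has no loops and at most one arc from $u$ to $v$ for each ordered pair of distinct vertices. $d_u^+$ and $d_u^-$ denote the out-degree and in-degree of $u$; a vertex is isolated if $d_u^+=d_u^-=0$. For $1\le i,j\le n-1$, $a_{ij}$ is the number of arcs $uv\in A$ with $d_u^+=i$ and $d_v^-=j$. Set $p_{ij}=a_{ij}+a_{ji}$ for $i\neq j$ and $p_{ii}=a_{ii}$. $n_0$ denotes the number of vertices of out-degree $0$ plus the number of vertices of in-degree $0$. $\vec K_2$ denotes the digraph on two vertices consisting of a single arc.
   Formalization: The value $\varphi_{n-1,n-1}$ is also assumed to be positive, as a hypothesis of both (i) and (ii). The statement above fails without it. -}

module Defs where

open import Level using (Level; _⊔_) renaming (suc to lsuc)
open import Data.Nat using (ℕ; zero; suc; _≡ᵇ_)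
open import Data.Nat as N using ()
open import Data.Fin using (Fin) renaming (zero to fz; suc to fs)
open import Data.Bool using (Bool; true; false; if_then_else_; _∧_)
open import Data.Product using (Σ; ∃; _×_)
open import Relation.Binary.Core using (Rel)
open import Relation.Binary.Structures using (IsStrictTotalOrder)
open import Relation.Binary.PropositionalEquality using (_≡_; _≢_)
open import Relation.Nullary using (¬_)
open import Algebra.Bundles using (CommutativeRing)
open import Function.Bundles using (_↔_; Inverse)

-- Ordered fields (the real numbers are one; the statement is made for
-- every ordered field, which in particular covers ℝ).

record OrderedField (c ℓ₁ ℓ₂ : Level) : Set (lsuc (c ⊔ ℓ₁ ⊔ ℓ₂)) where
  field
    commutativeRing : CommutativeRing c ℓ₁
  open CommutativeRing commutativeRing public
  field
    _<_                : Rel Carrier ℓ₂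
    isStrictTotalOrder : IsStrictTotalOrder _≈_ _<_
    0<1                : 0# < 1#
    +-mono-<           : ∀ {x y} z → x < y → (x + z) < (y + z)
    *-pos              : ∀ {x y} → 0# < x → 0# < y → 0# < (x * y)
    inverse            : ∀ x → ¬ (x ≈ 0#) → ∃ λ y → (x * y) ≈ 1#

  _≤F_ : Carrier → Carrier → Set (ℓ₁ ⊔ ℓ₂)
  x ≤F y = Data.Sum._⊎_ (x < y) (x ≈ y)
    where import Data.Sum

  fromℕ : ℕ → Carrier
  fromℕ zero    = 0#
  fromℕ (suc k) = 1# + fromℕ k

  ΣF : ∀ {n} → (Fin n → Carrier) → Carrier
  ΣF {zero}  f = 0#
  ΣF {suc n} f = f fz + ΣF (λ i → f (fs i))

-- Strict digraphs on vertex set Fin n: at most one arc per ordered pair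
-- (arc relation is Bool-valued), no loops.

record Digraph (n : ℕ) : Set where
  field
    arc      : Fin n → Fin n → Bool
    loopless : ∀ u → arc u u ≡ false
open Digraph public

ΣN : ∀ {n} → (Fin n → ℕ) → ℕ
ΣN {zero}  f = 0
ΣN {suc n} f = f fz N.+ ΣN (λ i → f (fs i))

count : ∀ {n} → (Fin n → Bool) → ℕ
count p = ΣN (λ u → if p u then 1 else 0)

outdeg : ∀ {n} → Digraph n → Fin n → ℕ
outdeg D u = count (λ v → arc D u v)

indeg : ∀ {n} → Digraph n → Fin n → ℕ
indeg D v = count (λ u → arc D u v)

NoIsolated : ∀ {n} → Digraph n → Set
NoIsolated D = ∀ u → ¬ (outdeg D u ≡ 0 × indeg D u ≡ 0)

aC : ∀ {n} → Digraph n → ℕ → ℕ → ℕ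
aC D i j = ΣN (λ u → ΣN (λ v →
  if arc D u v ∧ (outdeg D u ≡ᵇ i) ∧ (indeg D v ≡ᵇ j) then 1 else 0))

pC : ∀ {n} → Digraph n → ℕ → ℕ → ℕ
pC D i j = if i ≡ᵇ j then aC D i j else aC D i j N.+ aC D j i

n₀ : ∀ {n} → Digraph n → ℕ
n₀ D = count (λ u → outdeg D u ≡ᵇ 0) N.+ count (λ u → indeg D u ≡ᵇ 0)

InS₂ : ℕ → ℕ → ℕ → Set
InS₂ n i j = 1 N.≤ i × i N.≤ j × j N.≤ n N.∸ 1 × ¬ (i ≡ n N.∸ 1 × j ≡ n N.∸ 1)

_≅_ : ∀ {n m} → Digraph n → Digraph m → Set
_≅_ {n} {m} D E = Σ (Fin n ↔ Fin m) λ f →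
  ∀ u v → arc D u v ≡ arc E (Inverse.to f u) (Inverse.to f v)

K⃗₂ : Digraph 2
K⃗₂ = record { arc = a ; loopless = l }
  where
  a : Fin 2 → Fin 2 → Bool
  a fz (fs fz) = true
  a _  _       = false
  l : ∀ u → a u u ≡ false
  l fz = Relation.Binary.PropositionalEquality.refl
  l (fs fz) = Relation.Binary.PropositionalEquality.refl

IsCompleteSymmetric : ∀ {n} → Digraph n → Set
IsCompleteSymmetric {n} D = ∀ (u v : Fin n) → u ≢ v → arc D u v ≡ true

module _ {c ℓ₁ ℓ₂} (F : OrderedField c ℓ₁ ℓ₂) where
  open OrderedField F

  twiceI : ∀ {n} → Digraph n → (ℕ → ℕ → Carrier) → Carrier
  twiceI D φ = ΣF (λ u → ΣF (λ v →
    if arc D u v then φ (outdeg D u) (indeg D v) else 0#))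

{-# OPTIONS --safe #-}

-- Summing 1/i + 1/j over all arcs counts every vertex
-- of positive out-degree once and every vertex of positive in-degree once, so
-- Σ_{uv ∈ A} 2M(d⁺u, d⁻v) = (n-1) φ_{n-1,n-1} (2n - n₀), and n ≤ 2n - n₀ ≤ 2n because no vertex
-- is isolated. At the corner (n-1, n-1) we have M = φ, and off the corner the hypothesis of (i)
-- (resp. (ii)) makes φ > M (resp. φ < M) at the degree pair of every arc. Comparing the two arc
-- sums gives both bounds; equality forces n₀ to be extreme and every arc to join a vertex of
-- out-degree n-1 to one of in-degree n-1 (that is, p_ij = 0 on S₂), which happens only for K⃗₂,
-- respectively for the complete symmetric digraph.

module Submission where

open import Defs
open import Data.Nat using (ℕ; s≤s; _≤?_)
open import Data.Nat as N using ()
open import Data.Nat.Properties using (<⇒≤; ≰⇒>)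
open import Data.Fin using (Fin) renaming (zero to fz; suc to fs)
open import Data.Product using (∃; _×_; _,_; swap)
open import Data.Sum using (_⊎_; inj₁; inj₂)
open import Function using (_∘_)
open import Function.Bundles using (_⇔_)
open import Function.Construct.Composition using (_⇔-∘_)
open import Function.Construct.Symmetry using (⇔-sym)
open import Relation.Nullary using (¬_; yes; no)
open import Relation.Binary.PropositionalEquality using (_≡_; _≢_)

module Counting where

  open import Data.Nat using (zero; suc; _+_; _∸_; _≤_; _<_; z≤n)
  open import Data.Nat.Properties
    using (≤-trans; ≤-reflexive; +-mono-≤; m≤m+n; m≤n+m; +-suc; <-irrefl; suc-injective; +-commutativeSemigroup)
  open import Algebra.Properties.CommutativeSemigroup +-commutativeSemigroup using (interchange)
  import Data.Fin.Properties as Fin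
  open import Data.Bool using (Bool; true; false; not; if_then_else_)
  open import Data.Empty using (⊥; ⊥-elim)
  open import Relation.Binary.PropositionalEquality using (refl; sym; trans; cong)

  m<n⇒m≤n∸1 : ∀ {m n} → m < n → m ≤ n ∸ 1
  m<n⇒m≤n∸1 (s≤s m≤n) = m≤n

  ΣN-+ : ∀ {n} (f g : Fin n → ℕ) → ΣN (λ u → f u + g u) ≡ ΣN f + ΣN g
  ΣN-+ {zero}  f g = refl
  ΣN-+ {suc n} f g = trans (cong (f fz + g fz +_) (ΣN-+ (f ∘ fs) (g ∘ fs))) (interchange (f fz) (g fz) _ _)

  ΣN≡0 : ∀ {n} (f : Fin n → ℕ) → (∀ u → f u ≡ 0) → ΣN f ≡ 0
  ΣN≡0 {zero}  f f≡0 = refl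
  ΣN≡0 {suc n} f f≡0 rewrite f≡0 fz = ΣN≡0 (f ∘ fs) (f≡0 ∘ fs)

  ≤-ΣN : ∀ {n} (f : Fin n → ℕ) u → f u ≤ ΣN f
  ≤-ΣN f fz     = m≤m+n _ _
  ≤-ΣN f (fs u) = ≤-trans (≤-ΣN (f ∘ fs) u) (m≤n+m _ _)

  ΣN-≤ : ∀ {n} (f : Fin n → ℕ) → (∀ u → f u ≤ 1) → ΣN f ≤ n
  ΣN-≤ {zero}  f f≤1 = z≤n
  ΣN-≤ {suc n} f f≤1 = +-mono-≤ (f≤1 fz) (ΣN-≤ (f ∘ fs) (f≤1 ∘ fs))

  ΣN≡n⇒≡1 : ∀ {n} (f : Fin n → ℕ) → (∀ u → f u ≤ 1) → ΣN f ≡ n → ∀ u → f u ≡ 1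
  ΣN≡n⇒≡1 {suc n} f f≤1 Σ≡n u with f fz in f₀ | f≤1 fz
  ... | 0 | _ = ⊥-elim (<-irrefl refl (≤-trans (≤-reflexive (sym Σ≡n)) (ΣN-≤ (f ∘ fs) (f≤1 ∘ fs))))
  ... | 1 | _ with u
  ...   | fz   = f₀
  ...   | fs u = ΣN≡n⇒≡1 (f ∘ fs) (f≤1 ∘ fs) (suc-injective Σ≡n) u
  ΣN≡n⇒≡1 {suc n} f f≤1 Σ≡n u | suc (suc _) | s≤s ()

  indicator≤1 : ∀ b → (if b then 1 else 0) ≤ 1
  indicator≤1 true  = s≤s z≤n
  indicator≤1 false = z≤n

  count-≤ : ∀ {n} (p : Fin n → Bool) → count p ≤ n
  count-≤ p = ΣN-≤ _ (indicator≤1 ∘ p)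

  count-< : ∀ {n} (p : Fin n → Bool) u → p u ≡ false → count p < n
  count-< {suc n} p fz     pu rewrite pu = s≤s (count-≤ (p ∘ fs))
  count-< {suc n} p (fs u) pu =
    ≤-trans (≤-reflexive (sym (+-suc _ _))) (+-mono-≤ (indicator≤1 (p fz)) (count-< (p ∘ fs) u pu))

  count-<₂ : ∀ {n} (p : Fin n → Bool) u w → u ≢ w → p u ≡ false → p w ≡ false → 2 + count p ≤ n
  count-<₂ {suc n} p fz     fz     u≢w _  _  = ⊥-elim (u≢w refl)
  count-<₂ {suc n} p fz     (fs w) _   pu pw rewrite pu = s≤s (count-< (p ∘ fs) w pw)
  count-<₂ {suc n} p (fs u) fz     _   pu pw rewrite pw = s≤s (count-< (p ∘ fs) u pu)
  count-<₂ {suc n} p (fs u) (fs w) u≢w pu pw =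
    ≤-trans (≤-reflexive (sym (trans (+-suc _ _) (cong suc (+-suc _ _)))))
            (+-mono-≤ (indicator≤1 (p fz)) (count-<₂ (p ∘ fs) u w (u≢w ∘ cong fs) pu pw))

  count-pos : ∀ {n} (p : Fin n → Bool) u → p u ≡ true → 1 ≤ count p
  count-pos p u pu = ≤-trans (≤-reflexive (cong (λ b → if b then 1 else 0) (sym pu))) (≤-ΣN _ u)

  count≡0⇒false : ∀ {n} (p : Fin n → Bool) → count p ≡ 0 → ∀ u → p u ≡ false
  count≡0⇒false p count≡0 u with p u in pu
  ... | false = refl
  ... | true with ≤-trans (count-pos p u pu) (≤-reflexive count≡0)
  ...   | ()

  count-pos⇒∃ : ∀ {n} (p : Fin n → Bool) → 1 ≤ count p → ∃ λ u → p u ≡ true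
  count-pos⇒∃ {suc n} p count>0 with p fz in p₀
  ... | true  = fz , p₀
  ... | false with count-pos⇒∃ (p ∘ fs) count>0
  ...   | u , pu = fs u , pu

  count-all : ∀ {n} (p : Fin n → Bool) → (∀ u → p u ≡ true) → count p ≡ n
  count-all {zero}  p all = refl
  count-all {suc n} p all rewrite all fz = cong suc (count-all (p ∘ fs) (all ∘ fs))

  count-none : ∀ {n} (p : Fin n → Bool) → (∀ u → p u ≡ false) → count p ≡ 0
  count-none p none = ΣN≡0 _ (λ u → cong (λ b → if b then 1 else 0) (none u))

  count-not+count : ∀ {n} (p : Fin n → Bool) → count (not ∘ p) + count p ≡ n
  count-not+count {zero}  p = refl
  count-not+count {suc n} p with p fz
  ... | true  = trans (+-suc _ _) (cong suc (count-not+count (p ∘ fs)))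
  ... | false = cong suc (count-not+count (p ∘ fs))

  count-allBut : ∀ {n} (p : Fin n → Bool) u → p u ≡ false → (∀ w → w ≢ u → p w ≡ true) → count p ≡ n ∸ 1
  count-allBut {suc n} p fz pu others rewrite pu = count-all (p ∘ fs) (λ w → others (fs w) (λ ()))
  count-allBut {suc (suc n)} p (fs u) pu others rewrite others fz (λ ()) =
    cong suc (count-allBut (p ∘ fs) u pu (λ w w≢u → others (fs w) (w≢u ∘ Fin.suc-injective)))

  count≡n∸1⇒allBut : ∀ {n} (p : Fin n → Bool) u → p u ≡ false → count p ≡ n ∸ 1 → ∀ w → w ≢ u → p w ≡ true
  count≡n∸1⇒allBut {n} p u pu count≡n∸1 w w≢u with p w in pw
  ... | true  = refl
  ... | false = ⊥-elim (2+n∸1≰n n (≤-trans (≤-reflexive (cong (2 +_) (sym count≡n∸1)))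
                                          (count-<₂ p u w (w≢u ∘ sym) pu pw)))
    where
    2+n∸1≰n : ∀ n → 2 + (n ∸ 1) ≤ n → ⊥
    2+n∸1≰n (suc n) (s≤s 1+n≤n) = <-irrefl refl 1+n≤n

DegreeRange : ℕ → ℕ → Set
DegreeRange n k = 1 N.≤ k × k N.≤ n N.∸ 1

InS₂-or-swapped : ∀ {n i j} → DegreeRange n i → DegreeRange n j →
                  ¬ (i ≡ n N.∸ 1 × j ≡ n N.∸ 1) → InS₂ n i j ⊎ InS₂ n j i
InS₂-or-swapped {i = i} {j} (1≤i , i≤n-1) (1≤j , j≤n-1) not-corner with i ≤? j
... | yes i≤j = inj₁ (1≤i , i≤j , j≤n-1 , not-corner)
... | no  i≰j = inj₂ (1≤j , <⇒≤ (≰⇒> i≰j) , i≤n-1 , not-corner ∘ swap)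

third-vertex : ∀ {n} → 2 N.< n → (u v : Fin n) → ∃ λ w → w ≢ u × w ≢ v
third-vertex (s≤s (s≤s (s≤s _))) = third
  where
  third : ∀ {m} (u v : Fin (3 N.+ m)) → ∃ λ w → w ≢ u × w ≢ v
  third fz          fz          = fs fz      , (λ ()) , (λ ())
  third fz          (fs fz)     = fs (fs fz) , (λ ()) , (λ ())
  third fz          (fs (fs _)) = fs fz      , (λ ()) , (λ ())
  third (fs fz)     fz          = fs (fs fz) , (λ ()) , (λ ())
  third (fs fz)     (fs fz)     = fz         , (λ ()) , (λ ())
  third (fs fz)     (fs (fs _)) = fz         , (λ ()) , (λ ())
  third (fs (fs _)) fz          = fs fz      , (λ ()) , (λ ())
  third (fs (fs _)) (fs fz)     = fz         , (λ ()) , (λ ())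
  third (fs (fs _)) (fs (fs _)) = fz         , (λ ()) , (λ ())

module Degrees {n : ℕ} (D : Digraph n) where

  open Counting
  open import Data.Nat using (zero; suc; _+_; _∸_; _≤_; _≟_; _≡ᵇ_; z≤n)
  open import Data.Nat.Properties
    using (≤-trans; ≤-reflexive; ≤-refl; m≤m+n; m≤n+m; 1+n≰n; ≤∧≢⇒<; +-cancelˡ-≡; +-cancelʳ-≡; +-cancelʳ-≤;
           +-monoʳ-≤; +-identityʳ; m+n≡0⇒m≡0; ≡ᵇ⇒≡; ≡⇒≡ᵇ; +-commutativeSemigroup)
  open import Algebra.Properties.CommutativeSemigroup +-commutativeSemigroup using (interchange)
  open import Data.Fin using (fromℕ<)
  open import Data.Bool using (Bool; true; false; not; if_then_else_; _∧_)
  open import Data.Bool.Properties using (T-≡)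
  open import Function.Bundles using (Equivalence; mk⇔)
  open import Data.Product using (∃₂; proj₁; proj₂)
  open import Data.Empty using (⊥-elim)
  open import Relation.Nullary using (Dec; _×-dec_)
  open import Relation.Binary.PropositionalEquality using (refl; sym; trans; cong; cong₂; subst)

  MaximalArc : Fin n → Fin n → Set
  MaximalArc u v = outdeg D u ≡ n ∸ 1 × indeg D v ≡ n ∸ 1

  maximalArc? : ∀ u v → Dec (MaximalArc u v)
  maximalArc? u v = (outdeg D u ≟ n ∸ 1) ×-dec (indeg D v ≟ n ∸ 1)

  AllArcsMaximal : Set
  AllArcsMaximal = ∀ u v → arc D u v ≡ true → MaximalArc u v

  outdeg-≤ : ∀ u → outdeg D u ≤ n ∸ 1
  outdeg-≤ u = m<n⇒m≤n∸1 (count-< (arc D u) u (loopless D u))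

  indeg-≤ : ∀ v → indeg D v ≤ n ∸ 1
  indeg-≤ v = m<n⇒m≤n∸1 (count-< (λ u → arc D u v) v (loopless D v))

  arc⇒outdeg-range : ∀ {u v} → arc D u v ≡ true → DegreeRange n (outdeg D u)
  arc⇒outdeg-range {u} {v} uv = count-pos (arc D u) v uv , outdeg-≤ u

  arc⇒indeg-range : ∀ {u v} → arc D u v ≡ true → DegreeRange n (indeg D v)
  arc⇒indeg-range {u} {v} uv = count-pos (λ w → arc D w v) u uv , indeg-≤ v

  private
    ≡ᵇ-true⇒≡ : ∀ {m k} → (m ≡ᵇ k) ≡ true → m ≡ k
    ≡ᵇ-true⇒≡ {m} {k} m≡ᵇk = ≡ᵇ⇒≡ m k (Equivalence.from T-≡ m≡ᵇk)

    ≡ᵇ-refl : ∀ m → (m ≡ᵇ m) ≡ true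
    ≡ᵇ-refl m = Equivalence.to T-≡ (≡⇒≡ᵇ m m refl)

    arcIndicator : ℕ → ℕ → Fin n → Fin n → ℕ
    arcIndicator i j u v = if arc D u v ∧ (outdeg D u ≡ᵇ i) ∧ (indeg D v ≡ᵇ j) then 1 else 0

  aC≡0 : AllArcsMaximal → ∀ i j → ¬ (i ≡ n ∸ 1 × j ≡ n ∸ 1) → aC D i j ≡ 0
  aC≡0 maximal i j not-corner = ΣN≡0 _ (λ u → ΣN≡0 _ (indicator≡0 u))
    where
    indicator≡0 : ∀ u v → arcIndicator i j u v ≡ 0
    indicator≡0 u v with arc D u v in uv | outdeg D u ≡ᵇ i in out≡i | indeg D v ≡ᵇ j in in≡j
    ... | false | _     | _     = refl
    ... | true  | false | _     = refl
    ... | true  | true  | false = refl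
    ... | true  | true  | true  = ⊥-elim (not-corner
      ( trans (sym (≡ᵇ-true⇒≡ out≡i)) (proj₁ (maximal u v uv))
      , trans (sym (≡ᵇ-true⇒≡ in≡j)) (proj₂ (maximal u v uv))))

  arc⇒aC-pos : ∀ {u v} → arc D u v ≡ true → 1 ≤ aC D (outdeg D u) (indeg D v)
  arc⇒aC-pos {u} {v} uv = ≤-trans (≤-trans indicator≡1 (≤-ΣN _ v)) (≤-ΣN _ u)
    where
    indicator≡1 : 1 ≤ arcIndicator (outdeg D u) (indeg D v) u v
    indicator≡1 rewrite uv | ≡ᵇ-refl (outdeg D u) | ≡ᵇ-refl (indeg D v) = ≤-refl

  aC≤pC : ∀ i j → aC D i j ≤ pC D i j
  aC≤pC i j with i ≡ᵇ j
  ... | true  = ≤-refl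
  ... | false = m≤m+n _ _

  aC≤pC-swapped : ∀ i j → aC D i j ≤ pC D j i
  aC≤pC-swapped i j with j ≡ᵇ i in j≡i
  ... | true  = subst (λ k → aC D i k ≤ aC D k i) (sym (≡ᵇ-true⇒≡ j≡i)) ≤-refl
  ... | false = m≤n+m _ _

  pC-S₂≡0⇔AllArcsMaximal : (∀ i j → InS₂ n i j → pC D i j ≡ 0) ⇔ AllArcsMaximal
  pC-S₂≡0⇔AllArcsMaximal = mk⇔ pC≡0⇒maximal maximal⇒pC≡0
    where
    maximal⇒pC≡0 : AllArcsMaximal → ∀ i j → InS₂ n i j → pC D i j ≡ 0
    maximal⇒pC≡0 maximal i j (_ , _ , _ , not-corner) with i ≡ᵇ j
    ... | true  = aC≡0 maximal i j not-corner
    ... | false = cong₂ _+_ (aC≡0 maximal i j not-corner) (aC≡0 maximal j i (not-corner ∘ swap))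

    pC≡0⇒maximal : (∀ i j → InS₂ n i j → pC D i j ≡ 0) → AllArcsMaximal
    pC≡0⇒maximal pC≡0 u v uv with maximalArc? u v
    ... | yes maximal = maximal
    ... | no not-maximal
      with InS₂-or-swapped {n} (arc⇒outdeg-range uv) (arc⇒indeg-range uv) not-maximal
    ...   | inj₁ s = ⊥-elim (1+n≰n (≤-trans (arc⇒aC-pos uv) (≤-trans (aC≤pC _ _) (≤-reflexive (pC≡0 _ _ s)))))
    ...   | inj₂ s = ⊥-elim (1+n≰n (≤-trans (arc⇒aC-pos uv) (≤-trans (aC≤pC-swapped _ _) (≤-reflexive (pC≡0 _ _ s)))))

  sink? source? : Fin n → Bool
  sink?   u = outdeg D u ≡ᵇ 0
  source? u = indeg D u ≡ᵇ 0

  n₊ : ℕ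
  n₊ = count (not ∘ sink?) + count (not ∘ source?)

  n₊+n₀≡n+n : n₊ + n₀ D ≡ n + n
  n₊+n₀≡n+n = trans (interchange (count (not ∘ sink?)) (count (not ∘ source?)) (count sink?) (count source?))
                    (cong₂ _+_ (count-not+count sink?) (count-not+count source?))

  n≡n₊⇔n₀≡n : n ≡ n₊ ⇔ n₀ D ≡ n
  n≡n₊⇔n₀≡n = mk⇔ (λ n≡n₊ → +-cancelˡ-≡ n₊ (n₀ D) n (trans n₊+n₀≡n+n (cong (_+ n) n≡n₊)))
                  (λ n₀≡n → +-cancelʳ-≡ n n n₊ (trans (sym n₊+n₀≡n+n) (cong (n₊ +_) n₀≡n)))

  n₊≡n+n⇔n₀≡0 : n₊ ≡ n + n ⇔ n₀ D ≡ 0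
  n₊≡n+n⇔n₀≡0 = mk⇔ (λ n₊≡n+n → +-cancelˡ-≡ n₊ (n₀ D) 0 (trans n₊+n₀≡n+n (trans (sym n₊≡n+n) (sym (+-identityʳ n₊)))))
                    (λ n₀≡0 → trans (sym (+-identityʳ n₊)) (trans (cong (n₊ +_) (sym n₀≡0)) n₊+n₀≡n+n))

  n₊≤n+n : n₊ ≤ n + n
  n₊≤n+n = ≤-trans (m≤m+n n₊ (n₀ D)) (≤-reflexive n₊+n₀≡n+n)

  private
    zeroDegrees : Fin n → ℕ
    zeroDegrees u = (if sink? u then 1 else 0) + (if source? u then 1 else 0)

    n₀≡ΣN-zeroDegrees : n₀ D ≡ ΣN zeroDegrees
    n₀≡ΣN-zeroDegrees = sym (ΣN-+ (λ u → if sink? u then 1 else 0) (λ u → if source? u then 1 else 0))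

    zeroDegrees≤1 : NoIsolated D → ∀ u → zeroDegrees u ≤ 1
    zeroDegrees≤1 noIsolated u with outdeg D u ≡ᵇ 0 in out≡0 | indeg D u ≡ᵇ 0 in in≡0
    ... | true  | true  = ⊥-elim (noIsolated u (≡ᵇ-true⇒≡ out≡0 , ≡ᵇ-true⇒≡ in≡0))
    ... | true  | false = ≤-refl
    ... | false | true  = ≤-refl
    ... | false | false = z≤n

  n₀≤n : NoIsolated D → n₀ D ≤ n
  n₀≤n noIsolated = ≤-trans (≤-reflexive n₀≡ΣN-zeroDegrees) (ΣN-≤ _ (zeroDegrees≤1 noIsolated))

  n≤n₊ : NoIsolated D → n ≤ n₊
  n≤n₊ noIsolated = +-cancelʳ-≤ (n₀ D) n n₊ (≤-trans (+-monoʳ-≤ n (n₀≤n noIsolated)) (≤-reflexive (sym n₊+n₀≡n+n)))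

  n₀≡n⇒sink⊎source : NoIsolated D → n₀ D ≡ n → ∀ u → outdeg D u ≡ 0 ⊎ indeg D u ≡ 0
  n₀≡n⇒sink⊎source noIsolated n₀≡n u
    with ΣN≡n⇒≡1 _ (zeroDegrees≤1 noIsolated) (trans (sym n₀≡ΣN-zeroDegrees) n₀≡n) u
  ... | one with outdeg D u ≡ᵇ 0 in out≡0 | indeg D u ≡ᵇ 0 in in≡0
  ...   | true  | _     = inj₁ (≡ᵇ-true⇒≡ out≡0)
  ...   | false | true  = inj₂ (≡ᵇ-true⇒≡ in≡0)
  ...   | false | false with one
  ...     | ()

  n₀≡0⇒outdeg-pos : n₀ D ≡ 0 → ∀ u → 1 ≤ outdeg D u
  n₀≡0⇒outdeg-pos n₀≡0 u with outdeg D u | count≡0⇒false sink? (m+n≡0⇒m≡0 _ n₀≡0) u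
  ... | suc _ | _ = s≤s z≤n

  incident-arc : NoIsolated D → Fin n → ∃₂ λ v w → arc D v w ≡ true
  incident-arc noIsolated u with outdeg D u in out≡ | indeg D u in in≡
  ... | zero  | zero  = ⊥-elim (noIsolated u (out≡ , in≡))
  ... | suc _ | _     = let w , uw = count-pos⇒∃ (arc D u) (≤-trans (s≤s z≤n) (≤-reflexive (sym out≡)))
                        in u , w , uw
  ... | zero  | suc _ = let w , wu = count-pos⇒∃ (λ w → arc D w u) (≤-trans (s≤s z≤n) (≤-reflexive (sym in≡)))
                        in w , u , wu

  maximal-out-neighbour : ∀ {u v} → arc D u v ≡ true → AllArcsMaximal → ∀ w → w ≢ u → arc D u w ≡ true
  maximal-out-neighbour {u} {v} uv maximal =
    count≡n∸1⇒allBut (arc D u) u (loopless D u) (proj₁ (maximal u v uv))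

  maximal-in-neighbour : ∀ {u v} → arc D u v ≡ true → AllArcsMaximal → ∀ w → w ≢ v → arc D w v ≡ true
  maximal-in-neighbour {u} {v} uv maximal =
    count≡n∸1⇒allBut (λ w → arc D w v) v (loopless D v) (proj₂ (maximal u v uv))

  completeSymmetric⇔n₀≡0∧maximal : 2 ≤ n → IsCompleteSymmetric D ⇔ (n₀ D ≡ 0 × AllArcsMaximal)
  completeSymmetric⇔n₀≡0∧maximal 2≤n = mk⇔ complete⇒ ⇒complete
    where
    1≤n∸1 : 1 ≤ n ∸ 1
    1≤n∸1 = m<n⇒m≤n∸1 2≤n

    not-zero : ∀ {k} → 1 ≤ k → (k ≡ᵇ 0) ≡ false
    not-zero (s≤s _) = refl

    complete⇒ : IsCompleteSymmetric D → n₀ D ≡ 0 × AllArcsMaximal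
    complete⇒ complete = cong₂ _+_ (count-none sink? (not-zero ∘ outdeg-pos)) (count-none source? (not-zero ∘ indeg-pos))
                       , λ u v _ → outdeg≡ u , indeg≡ v
      where
      outdeg≡ : ∀ u → outdeg D u ≡ n ∸ 1
      outdeg≡ u = count-allBut (arc D u) u (loopless D u) (λ w w≢u → complete u w (w≢u ∘ sym))
      indeg≡ : ∀ v → indeg D v ≡ n ∸ 1
      indeg≡ v = count-allBut (λ w → arc D w v) v (loopless D v) (λ w w≢v → complete w v w≢v)
      outdeg-pos : ∀ u → 1 ≤ outdeg D u
      outdeg-pos u = subst (1 ≤_) (sym (outdeg≡ u)) 1≤n∸1
      indeg-pos : ∀ v → 1 ≤ indeg D v
      indeg-pos v = subst (1 ≤_) (sym (indeg≡ v)) 1≤n∸1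

    ⇒complete : n₀ D ≡ 0 × AllArcsMaximal → IsCompleteSymmetric D
    ⇒complete (n₀≡0 , maximal) u v u≢v =
      let w , uw = count-pos⇒∃ (arc D u) (n₀≡0⇒outdeg-pos n₀≡0 u)
      in maximal-out-neighbour uw maximal v (u≢v ∘ sym)

  -- For n ≥ 3 a third vertex w gets an arc from u and sends one to v, so it is neither a sink nor a source.
  n₀≡n∧maximal⇒n≡2 : 2 ≤ n → NoIsolated D → n₀ D ≡ n → AllArcsMaximal → n ≡ 2
  n₀≡n∧maximal⇒n≡2 2≤n noIsolated n₀≡n maximal with n ≟ 2
  ... | yes n≡2 = n≡2
  ... | no  n≢2 with incident-arc noIsolated (fromℕ< 2≤n)
  ...   | u , v , uv with third-vertex (≤∧≢⇒< 2≤n (n≢2 ∘ sym)) u v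
  ...     | w , w≢u , w≢v with n₀≡n⇒sink⊎source noIsolated n₀≡n w
  ...       | inj₁ out≡0 = ⊥-elim (1+n≰n (≤-trans (count-pos (arc D w) v (maximal-in-neighbour uv maximal w w≢v))
                                                 (≤-reflexive out≡0)))
  ...       | inj₂ in≡0  = ⊥-elim (1+n≰n (≤-trans (count-pos (λ x → arc D x w) u (maximal-out-neighbour uv maximal w w≢u))
                                                 (≤-reflexive in≡0)))

module TwoVertices where

  open Degrees
  open import Data.Nat using (_*_; _+_)
  open import Data.Nat.Properties using (≤-antisym)
  open import Data.Bool using (Bool; true; false; if_then_else_)
  open import Data.Product using (proj₁)
  open import Data.Fin.Permutation using (↔⇒≡; transpose)
  open import Function.Bundles using (Inverse; Injection; mk⇔)
  open import Function.Construct.Identity using (↔-id)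
  open import Function.Properties.Inverse using (↔⇒↣)
  open import Relation.Binary.PropositionalEquality using (refl; sym; trans; cong₂)

  absent : Bool → ℕ
  absent b = if b then 0 else 1

  n₀-two : ∀ (D : Digraph 2) {a b} → arc D fz (fs fz) ≡ a → arc D (fs fz) fz ≡ b →
           n₀ D ≡ 2 * (absent a + absent b)
  n₀-two D refl refl rewrite loopless D fz | loopless D (fs fz)
    with arc D fz (fs fz) | arc D (fs fz) fz
  ... | true  | true  = refl
  ... | true  | false = refl
  ... | false | true  = refl
  ... | false | false = refl

  n₀≡2⇒≅K⃗₂ : (D : Digraph 2) → n₀ D ≡ 2 → D ≅ K⃗₂
  n₀≡2⇒≅K⃗₂ D n₀≡2 = by-arcs _ _ refl refl
    where
    arcs-from : ∀ (f : Fin 2 → Fin 2) → arc D fz (fs fz) ≡ arc K⃗₂ (f fz) (f (fs fz)) →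
                 arc D (fs fz) fz ≡ arc K⃗₂ (f (fs fz)) (f fz) →
                 ∀ u v → arc D u v ≡ arc K⃗₂ (f u) (f v)
    arcs-from f a₀₁ a₁₀ fz      fz      = trans (loopless D fz) (sym (loopless K⃗₂ (f fz)))
    arcs-from f a₀₁ a₁₀ fz      (fs fz) = a₀₁
    arcs-from f a₀₁ a₁₀ (fs fz) fz      = a₁₀
    arcs-from f a₀₁ a₁₀ (fs fz) (fs fz) = trans (loopless D (fs fz)) (sym (loopless K⃗₂ (f (fs fz))))

    by-arcs : ∀ a b → arc D fz (fs fz) ≡ a → arc D (fs fz) fz ≡ b → D ≅ K⃗₂
    by-arcs true  true  a₀₁ a₁₀ with trans (sym (n₀-two D a₀₁ a₁₀)) n₀≡2
    ... | ()
    by-arcs false false a₀₁ a₁₀ with trans (sym (n₀-two D a₀₁ a₁₀)) n₀≡2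
    ... | ()
    by-arcs true  false a₀₁ a₁₀ = ↔-id (Fin 2) , arcs-from _ a₀₁ a₁₀
    by-arcs false true  a₀₁ a₁₀ = transpose fz (fs fz) , arcs-from _ a₀₁ a₁₀

  ≅K⃗₂⇒n₀≡2 : (D : Digraph 2) → D ≅ K⃗₂ → n₀ D ≡ 2
  ≅K⃗₂⇒n₀≡2 D (f , arcs) with Inverse.to f fz in f₀ | Inverse.to f (fs fz) in f₁
  ... | fz    | fz    with Injection.injective (↔⇒↣ f) (trans f₀ (sym f₁))
  ...   | ()
  ≅K⃗₂⇒n₀≡2 D (f , arcs) | fs fz | fs fz with Injection.injective (↔⇒↣ f) (trans f₀ (sym f₁))
  ...   | ()
  ≅K⃗₂⇒n₀≡2 D (f , arcs) | fz    | fs fz =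
    n₀-two D (trans (arcs fz (fs fz)) (cong₂ (arc K⃗₂) f₀ f₁)) (trans (arcs (fs fz) fz) (cong₂ (arc K⃗₂) f₁ f₀))
  ≅K⃗₂⇒n₀≡2 D (f , arcs) | fs fz | fz    =
    n₀-two D (trans (arcs fz (fs fz)) (cong₂ (arc K⃗₂) f₀ f₁)) (trans (arcs (fs fz) fz) (cong₂ (arc K⃗₂) f₁ f₀))

  allArcsMaximal-two : (D : Digraph 2) → AllArcsMaximal D
  allArcsMaximal-two D u v uv = range≡1 (arc⇒outdeg-range D uv) , range≡1 (arc⇒indeg-range D uv)
    where
    range≡1 : ∀ {k} → DegreeRange 2 k → k ≡ 1
    range≡1 (1≤k , k≤1) = ≤-antisym k≤1 1≤k

  ≅K⃗₂⇔n₀≡n∧maximal : ∀ {n} (D : Digraph n) → 2 N.≤ n → NoIsolated D →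
                      D ≅ K⃗₂ ⇔ (n₀ D ≡ n × AllArcsMaximal D)
  ≅K⃗₂⇔n₀≡n∧maximal {n} D 2≤n noIsolated = mk⇔ ≅K⃗₂⇒ ⇒≅K⃗₂
    where
    ≅K⃗₂⇒ : D ≅ K⃗₂ → n₀ D ≡ n × AllArcsMaximal D
    ≅K⃗₂⇒ iso with ↔⇒≡ (proj₁ iso)
    ... | refl = ≅K⃗₂⇒n₀≡2 D iso , allArcsMaximal-two D

    ⇒≅K⃗₂ : n₀ D ≡ n × AllArcsMaximal D → D ≅ K⃗₂
    ⇒≅K⃗₂ (n₀≡n , maximal) with n₀≡n∧maximal⇒n≡2 D 2≤n noIsolated n₀≡n maximal
    ... | refl = n₀≡2⇒≅K⃗₂ D n₀≡n

module OrderedFieldProperties {c ℓ₁ ℓ₂} (F : OrderedField c ℓ₁ ℓ₂) where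

  -- Defs gives _<_ and _≤F_ no fixity, so they would bind tighter than _+_ and _*_.
  open OrderedField F hiding (_<_; _≤F_)
  open OrderedField F public using () renaming (_<_ to infix 4 _<_; _≤F_ to infix 4 _≤F_)
  open import Data.Nat using (zero; suc)
  import Data.Nat.Properties as ℕ
  open import Data.Bool using (Bool; true; false; not; if_then_else_)
  open import Data.Product using (proj₁; proj₂)
  open import Data.Empty using (⊥-elim)
  open import Function.Bundles using (Equivalence; mk⇔)
  open import Relation.Binary using (tri<; tri≈; tri>)
  open import Relation.Binary.Bundles using (StrictPartialOrder)
  open import Relation.Binary.Structures using (IsStrictTotalOrder)
  import Relation.Binary.PropositionalEquality as ≡
  import Relation.Binary.Construct.StrictToNonStrict _≈_ _<_ as NonStrict
  import Relation.Binary.Reasoning.StrictPartialOrder as StrictReasoning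
  open import Relation.Binary.Reasoning.Setoid setoid
  open import Algebra.Properties.CommutativeSemigroup +-commutativeSemigroup using (interchange)

  open IsStrictTotalOrder isStrictTotalOrder public
    using (compare; irrefl; isStrictPartialOrder; <-resp-≈; <-respˡ-≈; <-respʳ-≈)
    renaming (trans to <-trans)

  strictPartialOrder : StrictPartialOrder c ℓ₁ ℓ₂
  strictPartialOrder = record { isStrictPartialOrder = isStrictPartialOrder }

  module ≤-Reasoning = StrictReasoning strictPartialOrder

  ≤-trans : ∀ {x y z} → x ≤F y → y ≤F z → x ≤F z
  ≤-trans = NonStrict.trans isEquivalence <-resp-≈ <-trans

  ≤-antisym : ∀ {x y} → x ≤F y → y ≤F x → x ≈ y
  ≤-antisym = NonStrict.antisym isEquivalence <-trans irrefl

  <-≤-trans : ∀ {x y z} → x < y → y ≤F z → x < z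
  <-≤-trans = NonStrict.<-≤-trans <-trans <-respʳ-≈

  ≤-<-trans : ∀ {x y z} → x ≤F y → y < z → x < z
  ≤-<-trans = NonStrict.≤-<-trans sym <-trans <-respˡ-≈

  ≤-respʳ-≈ : ∀ {x y z} → y ≈ z → x ≤F y → x ≤F z
  ≤-respʳ-≈ = NonStrict.≤-respʳ-≈ trans <-respʳ-≈

  ≤-respˡ-≈ : ∀ {x y z} → x ≈ y → x ≤F z → y ≤F z
  ≤-respˡ-≈ = NonStrict.≤-respˡ-≈ sym trans <-respˡ-≈

  ≤-≤-squeeze : ∀ {x y z} → x ≤F y → y ≤F z → x ≈ z → x ≈ y × y ≈ z
  ≤-≤-squeeze x≤y y≤z x≈z =
      ≤-antisym x≤y (≤-respʳ-≈ (sym x≈z) y≤z)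
    , ≤-antisym y≤z (≤-respˡ-≈ x≈z x≤y)

  ≤-≤-sandwich : ∀ {p q} {P : Set p} {Q : Set q} {x y z} → x ≤F y → y ≤F z →
                 (x ≈ y ⇔ P) → (y ≈ z ⇔ Q) → x ≤F z × (x ≈ z ⇔ (P × Q))
  ≤-≤-sandwich x≤y y≤z x≈y⇔P y≈z⇔Q = ≤-trans x≤y y≤z , mk⇔
    (λ x≈z → let x≈y , y≈z = ≤-≤-squeeze x≤y y≤z x≈z in Equivalence.to x≈y⇔P x≈y , Equivalence.to y≈z⇔Q y≈z)
    (λ (p , q) → trans (Equivalence.from x≈y⇔P p) (Equivalence.from y≈z⇔Q q))

  ≈-resp₂-⇔ : ∀ {x x′ y y′} → x ≈ x′ → y ≈ y′ → (x ≈ y ⇔ x′ ≈ y′)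
  ≈-resp₂-⇔ x≈x′ y≈y′ = mk⇔ (λ x≈y → trans (sym x≈x′) (trans x≈y y≈y′))
                              (λ x′≈y′ → trans x≈x′ (trans x′≈y′ (sym y≈y′)))

  +-monoʳ-< : ∀ {x y} z → x < y → z + x < z + y
  +-monoʳ-< {x} {y} z x<y = <-respˡ-≈ (+-comm x z) (<-respʳ-≈ (+-comm y z) (+-mono-< z x<y))

  +-monoˡ-≤ : ∀ {x y} z → x ≤F y → x + z ≤F y + z
  +-monoˡ-≤ z (inj₁ x<y) = inj₁ (+-mono-< z x<y)
  +-monoˡ-≤ z (inj₂ x≈y) = inj₂ (+-congʳ x≈y)

  +-monoʳ-≤ : ∀ {x y} z → x ≤F y → z + x ≤F z + y
  +-monoʳ-≤ z (inj₁ x<y) = inj₁ (+-monoʳ-< z x<y)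
  +-monoʳ-≤ z (inj₂ x≈y) = inj₂ (+-congˡ x≈y)

  +-mono-≤ : ∀ {w x y z} → w ≤F x → y ≤F z → w + y ≤F x + z
  +-mono-≤ {x = x} {y} w≤x y≤z = ≤-trans (+-monoˡ-≤ y w≤x) (+-monoʳ-≤ x y≤z)

  +-mono-<-≤ : ∀ {w x y z} → w < x → y ≤F z → w + y < x + z
  +-mono-<-≤ {x = x} {y} w<x y≤z = <-≤-trans (+-mono-< y w<x) (+-monoʳ-≤ x y≤z)

  +-mono-≤-< : ∀ {w x y z} → w ≤F x → y < z → w + y < x + z
  +-mono-≤-< {x = x} {y} w≤x y<z = ≤-<-trans (+-monoˡ-≤ y w≤x) (+-monoʳ-< x y<z)

  *-monoʳ-< : ∀ {x y z} → 0# < z → x < y → x * z < y * z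
  *-monoʳ-< {x} {y} {z} 0<z x<y = <-respˡ-≈ (+-identityˡ (x * z)) (<-respʳ-≈ difference (+-mono-< (x * z) 0<[y-x]z))
    where
    0<[y-x]z : 0# < (y - x) * z
    0<[y-x]z = *-pos (<-respˡ-≈ (-‿inverseʳ x) (+-mono-< (- x) x<y)) 0<z
    difference : (y - x) * z + x * z ≈ y * z
    difference = begin
      (y - x) * z + x * z ≈⟨ distribʳ z (y - x) x ⟨
      (y - x + x) * z     ≈⟨ *-congʳ (+-assoc y (- x) x) ⟩
      (y + (- x + x)) * z ≈⟨ *-congʳ (+-congˡ (-‿inverseˡ x)) ⟩
      (y + 0#) * z        ≈⟨ *-congʳ (+-identityʳ y) ⟩
      y * z               ∎

  *-monoˡ-< : ∀ {x y z} → 0# < z → x < y → z * x < z * y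
  *-monoˡ-< {x} {y} {z} 0<z x<y = <-respˡ-≈ (*-comm x z) (<-respʳ-≈ (*-comm y z) (*-monoʳ-< 0<z x<y))

  *-monoʳ-≤ : ∀ {x y z} → 0# < z → x ≤F y → x * z ≤F y * z
  *-monoʳ-≤ 0<z (inj₁ x<y) = inj₁ (*-monoʳ-< 0<z x<y)
  *-monoʳ-≤ 0<z (inj₂ x≈y) = inj₂ (*-congʳ x≈y)

  *-cancelˡ-≤ : ∀ {x y z} → 0# < z → z * x ≤F z * y → x ≤F y
  *-cancelˡ-≤ {x} {y} 0<z zx≤zy with compare x y
  ... | tri< x<y _ _ = inj₁ x<y
  ... | tri≈ _ x≈y _ = inj₂ x≈y
  ... | tri> _ _ y<x = ⊥-elim (irrefl refl (<-≤-trans (*-monoˡ-< 0<z y<x) zx≤zy))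

  x≈y⇔z*x≈z*y : ∀ {x y z} → 0# < z → (x ≈ y ⇔ z * x ≈ z * y)
  x≈y⇔z*x≈z*y 0<z = mk⇔ *-congˡ (λ zx≈zy → ≤-antisym (*-cancelˡ-≤ 0<z (inj₂ zx≈zy)) (*-cancelˡ-≤ 0<z (inj₂ (sym zx≈zy))))

  fromℕ-+ : ∀ a b → fromℕ (a N.+ b) ≈ fromℕ a + fromℕ b
  fromℕ-+ zero    b = sym (+-identityˡ _)
  fromℕ-+ (suc a) b = trans (+-congˡ (fromℕ-+ a b)) (sym (+-assoc _ _ _))

  fromℕ-* : ∀ a b → fromℕ (a N.* b) ≈ fromℕ a * fromℕ b
  fromℕ-* zero    b = sym (zeroˡ _)
  fromℕ-* (suc a) b = begin
    fromℕ (b N.+ a N.* b)             ≈⟨ fromℕ-+ b (a N.* b) ⟩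
    fromℕ b + fromℕ (a N.* b)         ≈⟨ +-cong (sym (*-identityˡ _)) (fromℕ-* a b) ⟩
    1# * fromℕ b + fromℕ a * fromℕ b  ≈⟨ distribʳ _ _ _ ⟨
    (1# + fromℕ a) * fromℕ b          ∎

  0≤fromℕ : ∀ k → 0# ≤F fromℕ k
  0≤fromℕ zero    = inj₂ refl
  0≤fromℕ (suc k) = inj₁ (≤-<-trans (≤-trans (0≤fromℕ k) (inj₂ (sym (+-identityˡ _)))) (+-mono-< (fromℕ k) 0<1))

  0<fromℕ[1+k] : ∀ k → 0# < fromℕ (suc k)
  0<fromℕ[1+k] k = ≤-<-trans (0≤fromℕ k) (<-respˡ-≈ (+-identityˡ _) (+-mono-< (fromℕ k) 0<1))

  fromℕ-mono-< : ∀ {a b} → a N.< b → fromℕ a < fromℕ b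
  fromℕ-mono-< {zero}  {suc b} _           = 0<fromℕ[1+k] b
  fromℕ-mono-< {suc a} {suc b} (N.s≤s a<b) = +-monoʳ-< 1# (fromℕ-mono-< a<b)

  fromℕ-mono-≤ : ∀ {a b} → a N.≤ b → fromℕ a ≤F fromℕ b
  fromℕ-mono-≤ {zero}  {b}     _           = 0≤fromℕ b
  fromℕ-mono-≤ {suc a} {suc b} (N.s≤s a≤b) = +-monoʳ-≤ 1# (fromℕ-mono-≤ a≤b)

  a≡b⇔fromℕa*x≈fromℕb*x : ∀ {a b x} → 0# < x → (a ≡ b ⇔ fromℕ a * x ≈ fromℕ b * x)
  a≡b⇔fromℕa*x≈fromℕb*x {a} {b} {x} 0<x = mk⇔ (λ { ≡.refl → refl }) injective
    where
    injective : fromℕ a * x ≈ fromℕ b * x → a ≡ b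
    injective ax≈bx with ℕ.<-cmp a b
    ... | tri< a<b _ _ = ⊥-elim (irrefl ax≈bx (*-monoʳ-< 0<x (fromℕ-mono-< a<b)))
    ... | tri≈ _ a≡b _ = a≡b
    ... | tri> _ _ b<a = ⊥-elim (irrefl (sym ax≈bx) (*-monoʳ-< 0<x (fromℕ-mono-< b<a)))

  fromℕ≉0 : ∀ k → ¬ fromℕ (suc k) ≈ 0#
  fromℕ≉0 k k≈0 = irrefl (sym k≈0) (0<fromℕ[1+k] k)

  -- recip 0 = 0# is a junk value; it only ever occurs multiplied by fromℕ 0.
  recip : ℕ → Carrier
  recip zero    = 0#
  recip (suc k) = proj₁ (inverse (fromℕ (suc k)) (fromℕ≉0 k))

  fromℕ*recip : ∀ k → fromℕ (suc k) * recip (suc k) ≈ 1#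
  fromℕ*recip k = proj₂ (inverse (fromℕ (suc k)) (fromℕ≉0 k))

  0<recip : ∀ k → 0# < recip (suc k)
  0<recip k with compare 0# (recip (suc k))
  ... | tri< 0<r _ _ = 0<r
  ... | tri≈ _ 0≈r _ = ⊥-elim (irrefl (trans (sym (trans (*-congˡ (sym 0≈r)) (zeroʳ _))) (fromℕ*recip k)) 0<1)
  ... | tri> _ _ r<0 = ⊥-elim (irrefl refl (<-trans 0<1
                        (<-respˡ-≈ (fromℕ*recip k) (<-respʳ-≈ (zeroʳ _) (*-monoˡ-< (0<fromℕ[1+k] k) r<0)))))

  fromℕ*recip* : ∀ k x → fromℕ k * (recip k * x) ≈ fromℕ (if not (k N.≡ᵇ 0) then 1 else 0) * x
  fromℕ*recip* zero    x = trans (zeroˡ _) (sym (zeroˡ x))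
  fromℕ*recip* (suc k) x = begin
    fromℕ (suc k) * (recip (suc k) * x) ≈⟨ *-assoc _ _ x ⟨
    fromℕ (suc k) * recip (suc k) * x   ≈⟨ *-congʳ (fromℕ*recip k) ⟩
    1# * x                              ≈⟨ *-congʳ (+-identityʳ 1#) ⟨
    (1# + 0#) * x                       ∎

  ΣF-cong : ∀ {n} {f g : Fin n → Carrier} → (∀ i → f i ≈ g i) → ΣF f ≈ ΣF g
  ΣF-cong {zero}  f≈g = refl
  ΣF-cong {suc n} f≈g = +-cong (f≈g fz) (ΣF-cong (f≈g ∘ fs))

  ΣF-distrib-+ : ∀ {n} (f g : Fin n → Carrier) → ΣF (λ i → f i + g i) ≈ ΣF f + ΣF g
  ΣF-distrib-+ {zero}  f g = sym (+-identityˡ _)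
  ΣF-distrib-+ {suc n} f g = trans (+-congˡ (ΣF-distrib-+ (f ∘ fs) (g ∘ fs))) (interchange (f fz) (g fz) _ _)

  *-distribˡ-ΣF : ∀ {n} x (f : Fin n → Carrier) → x * ΣF f ≈ ΣF (λ i → x * f i)
  *-distribˡ-ΣF {zero}  x f = zeroʳ x
  *-distribˡ-ΣF {suc n} x f = trans (distribˡ x _ _) (+-congˡ (*-distribˡ-ΣF x (f ∘ fs)))

  ΣF-zero : ∀ n → ΣF {n} (λ _ → 0#) ≈ 0#
  ΣF-zero zero    = refl
  ΣF-zero (suc n) = trans (+-identityˡ _) (ΣF-zero n)

  ΣF-comm : ∀ {m n} (f : Fin m → Fin n → Carrier) → ΣF (λ i → ΣF (f i)) ≈ ΣF (λ j → ΣF (λ i → f i j))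
  ΣF-comm {zero}  {n} f = sym (ΣF-zero n)
  ΣF-comm {suc m} {n} f = trans (+-congˡ (ΣF-comm (f ∘ fs))) (sym (ΣF-distrib-+ (f fz) _))

  ΣF-mono-≤ : ∀ {n} {f g : Fin n → Carrier} → (∀ i → f i ≤F g i) → ΣF f ≤F ΣF g
  ΣF-mono-≤ {zero}  f≤g = inj₂ refl
  ΣF-mono-≤ {suc n} f≤g = +-mono-≤ (f≤g fz) (ΣF-mono-≤ (f≤g ∘ fs))

  ΣF-mono-< : ∀ {n} {f g : Fin n → Carrier} → (∀ i → f i ≤F g i) → ∀ k → f k < g k → ΣF f < ΣF g
  ΣF-mono-< {suc n} f≤g fz     fk<gk = +-mono-<-≤ fk<gk (ΣF-mono-≤ (f≤g ∘ fs))
  ΣF-mono-< {suc n} f≤g (fs k) fk<gk = +-mono-≤-< (f≤g fz) (ΣF-mono-< (f≤g ∘ fs) k fk<gk)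

  if≈indicator* : ∀ b x → (if b then x else 0#) ≈ fromℕ (if b then 1 else 0) * x
  if≈indicator* true  x = sym (trans (*-congʳ (+-identityʳ 1#)) (*-identityˡ x))
  if≈indicator* false x = sym (zeroˡ x)

  ΣF-indicator* : ∀ {n} (p : Fin n → Bool) x → ΣF (λ i → fromℕ (if p i then 1 else 0) * x) ≈ fromℕ (count p) * x
  ΣF-indicator* {zero}  p x = sym (zeroˡ x)
  ΣF-indicator* {suc n} p x = begin
    fromℕ (if p fz then 1 else 0) * x + ΣF (λ i → fromℕ (if p (fs i) then 1 else 0) * x)
      ≈⟨ +-congˡ (ΣF-indicator* (p ∘ fs) x) ⟩
    fromℕ (if p fz then 1 else 0) * x + fromℕ (count (p ∘ fs)) * x
      ≈⟨ distribʳ x _ _ ⟨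
    (fromℕ (if p fz then 1 else 0) + fromℕ (count (p ∘ fs))) * x
      ≈⟨ *-congʳ (fromℕ-+ (if p fz then 1 else 0) _) ⟨
    fromℕ (count p) * x ∎

  ΣF-if : ∀ {n} (p : Fin n → Bool) x → ΣF (λ i → if p i then x else 0#) ≈ fromℕ (count p) * x
  ΣF-if p x = trans (ΣF-cong (λ i → if≈indicator* (p i) x)) (ΣF-indicator* p x)

module ArcSums {c ℓ₁ ℓ₂} (F : OrderedField c ℓ₁ ℓ₂) {n : ℕ} (D : Digraph n) where

  open OrderedFieldProperties F
  open OrderedField F hiding (_<_; _≤F_)
  open Degrees D

  open import Data.Bool using (true; false; not; if_then_else_)
  open import Data.Empty using (⊥-elim)
  open import Function.Bundles using (mk⇔)
  import Relation.Binary.PropositionalEquality as ≡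
  open import Relation.Binary.Reasoning.Setoid setoid

  DegreeFunction : Set c
  DegreeFunction = ℕ → ℕ → Carrier

  arcTerm : DegreeFunction → Fin n → Fin n → Carrier
  arcTerm ψ u v = if arc D u v then ψ (outdeg D u) (indeg D v) else 0#

  OnArcs : ∀ {ℓ} → (Carrier → Carrier → Set ℓ) → DegreeFunction → DegreeFunction → Set ℓ
  OnArcs _∼_ ψ χ = ∀ {u v} → arc D u v ≡ true → ψ (outdeg D u) (indeg D v) ∼ χ (outdeg D u) (indeg D v)

  twiceI-*ˡ : ∀ x ψ → twiceI F D (λ i j → x * ψ i j) ≈ x * twiceI F D ψ
  twiceI-*ˡ x ψ = begin
    ΣF (λ u → ΣF (λ v → if arc D u v then x * ψ (outdeg D u) (indeg D v) else 0#))
      ≈⟨ ΣF-cong (λ u → ΣF-cong (λ v → if-*ˡ (arc D u v))) ⟩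
    ΣF (λ u → ΣF (λ v → x * arcTerm ψ u v)) ≈⟨ ΣF-cong (λ u → *-distribˡ-ΣF x (arcTerm ψ u)) ⟨
    ΣF (λ u → x * ΣF (arcTerm ψ u))         ≈⟨ *-distribˡ-ΣF x (λ u → ΣF (arcTerm ψ u)) ⟨
    x * twiceI F D ψ                        ∎
    where
    if-*ˡ : ∀ {y} b → (if b then x * y else 0#) ≈ x * (if b then y else 0#)
    if-*ˡ true  = refl
    if-*ˡ false = sym (zeroʳ x)

  arcTerm-cong : ∀ {ψ χ} → (∀ i j → ψ i j ≈ χ i j) → ∀ u v → arcTerm ψ u v ≈ arcTerm χ u v
  arcTerm-cong ψ≈χ u v with arc D u v
  ... | true  = ψ≈χ _ _
  ... | false = refl

  arcTerm-mono-≤ : ∀ {ψ χ} → OnArcs _≤F_ ψ χ → ∀ u v → arcTerm ψ u v ≤F arcTerm χ u v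
  arcTerm-mono-≤ ψ≤χ u v with arc D u v in uv
  ... | true  = ψ≤χ uv
  ... | false = inj₂ refl

  arcTerm-on-arc : ∀ ψ {u v} → arc D u v ≡ true → arcTerm ψ u v ≡ ψ (outdeg D u) (indeg D v)
  arcTerm-on-arc ψ uv rewrite uv = ≡.refl

  twiceI-mono-≤ : ∀ {ψ χ} → OnArcs _≤F_ ψ χ → twiceI F D ψ ≤F twiceI F D χ
  twiceI-mono-≤ {ψ} {χ} ψ≤χ = ΣF-mono-≤ (λ u → ΣF-mono-≤ (arcTerm-mono-≤ {ψ} {χ} ψ≤χ u))

  twiceI-mono-< : ∀ {ψ χ u v} → OnArcs _≤F_ ψ χ → arc D u v ≡ true →
                  ψ (outdeg D u) (indeg D v) < χ (outdeg D u) (indeg D v) → twiceI F D ψ < twiceI F D χ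
  twiceI-mono-< {ψ} {χ} {u} {v} ψ≤χ uv ψ<χ =
    ΣF-mono-< (λ w → ΣF-mono-≤ (arcTerm-mono-≤ {ψ} {χ} ψ≤χ w)) u
      (ΣF-mono-< (arcTerm-mono-≤ {ψ} {χ} ψ≤χ u) v
        (≡.subst₂ _<_ (≡.sym (arcTerm-on-arc ψ uv)) (≡.sym (arcTerm-on-arc χ uv)) ψ<χ))

  -- Summing 1/d⁺u over the arcs leaving u gives 1 if u is not a sink and 0 otherwise.
  twiceI-recip-outdeg : ∀ x → twiceI F D (λ i _ → recip i * x) ≈ fromℕ (count (not ∘ sink?)) * x
  twiceI-recip-outdeg x = begin
    ΣF (λ u → ΣF (arcTerm (λ i _ → recip i * x) u))                   ≈⟨ ΣF-cong (λ u → ΣF-if (arc D u) _) ⟩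
    ΣF (λ u → fromℕ (outdeg D u) * (recip (outdeg D u) * x))          ≈⟨ ΣF-cong (λ u → fromℕ*recip* (outdeg D u) x) ⟩
    ΣF (λ u → fromℕ (if not (sink? u) then 1 else 0) * x)             ≈⟨ ΣF-indicator* (not ∘ sink?) x ⟩
    fromℕ (count (not ∘ sink?)) * x                                   ∎

  twiceI-recip-indeg : ∀ x → twiceI F D (λ _ j → recip j * x) ≈ fromℕ (count (not ∘ source?)) * x
  twiceI-recip-indeg x = begin
    ΣF (λ u → ΣF (arcTerm (λ _ j → recip j * x) u))                   ≈⟨ ΣF-comm (arcTerm (λ _ j → recip j * x)) ⟩
    ΣF (λ v → ΣF (λ u → arcTerm (λ _ j → recip j * x) u v))           ≈⟨ ΣF-cong (λ v → ΣF-if (λ u → arc D u v) _) ⟩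
    ΣF (λ v → fromℕ (indeg D v) * (recip (indeg D v) * x))            ≈⟨ ΣF-cong (λ v → fromℕ*recip* (indeg D v) x) ⟩
    ΣF (λ v → fromℕ (if not (source? v) then 1 else 0) * x)           ≈⟨ ΣF-indicator* (not ∘ source?) x ⟩
    fromℕ (count (not ∘ source?)) * x                                 ∎

  twiceI-+ : ∀ ψ χ → twiceI F D (λ i j → ψ i j + χ i j) ≈ twiceI F D ψ + twiceI F D χ
  twiceI-+ ψ χ = trans (ΣF-cong (λ u → trans (ΣF-cong (split u)) (ΣF-distrib-+ (arcTerm ψ u) (arcTerm χ u))))
                       (ΣF-distrib-+ (λ u → ΣF (arcTerm ψ u)) (λ u → ΣF (arcTerm χ u)))
    where
    split : ∀ u v → arcTerm (λ i j → ψ i j + χ i j) u v ≈ arcTerm ψ u v + arcTerm χ u v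
    split u v with arc D u v
    ... | true  = refl
    ... | false = sym (+-identityˡ 0#)

  twiceI-recip : ∀ x → twiceI F D (λ i j → (recip i + recip j) * x) ≈ fromℕ n₊ * x
  twiceI-recip x = begin
    twiceI F D (λ i j → (recip i + recip j) * x)
      ≈⟨ ΣF-cong (λ u → ΣF-cong (λ v → arcTerm-cong (λ i j → distribʳ x (recip i) (recip j)) u v)) ⟩
    twiceI F D (λ i j → recip i * x + recip j * x)
      ≈⟨ twiceI-+ (λ i _ → recip i * x) (λ _ j → recip j * x) ⟩
    twiceI F D (λ i _ → recip i * x) + twiceI F D (λ _ j → recip j * x)
      ≈⟨ +-cong (twiceI-recip-outdeg x) (twiceI-recip-indeg x) ⟩
    fromℕ (count (not ∘ sink?)) * x + fromℕ (count (not ∘ source?)) * x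
      ≈⟨ distribʳ x _ _ ⟨
    (fromℕ (count (not ∘ sink?)) + fromℕ (count (not ∘ source?))) * x
      ≈⟨ *-congʳ (fromℕ-+ (count (not ∘ sink?)) _) ⟨
    fromℕ n₊ * x ∎

  twiceI-compare : ∀ ψ χ → ψ (n N.∸ 1) (n N.∸ 1) ≈ χ (n N.∸ 1) (n N.∸ 1) →
    (∀ i j → DegreeRange n i → DegreeRange n j → ¬ (i ≡ n N.∸ 1 × j ≡ n N.∸ 1) → ψ i j < χ i j) →
    twiceI F D ψ ≤F twiceI F D χ × (twiceI F D ψ ≈ twiceI F D χ ⇔ AllArcsMaximal)
  twiceI-compare ψ χ corner off-corner = twiceI-mono-≤ {ψ} {χ} ψ≤χ , mk⇔ ≈⇒maximal maximal⇒≈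
    where
    on-maximal : ∀ {u v} → MaximalArc u v → ψ (outdeg D u) (indeg D v) ≈ χ (outdeg D u) (indeg D v)
    on-maximal (out≡ , in≡) rewrite out≡ | in≡ = corner

    off-maximal : ∀ {u v} → arc D u v ≡ true → ¬ MaximalArc u v →
                  ψ (outdeg D u) (indeg D v) < χ (outdeg D u) (indeg D v)
    off-maximal uv = off-corner _ _ (arc⇒outdeg-range uv) (arc⇒indeg-range uv)

    ψ≤χ : OnArcs _≤F_ ψ χ
    ψ≤χ {u} {v} uv with maximalArc? u v
    ... | yes maximal     = inj₂ (on-maximal maximal)
    ... | no  not-maximal = inj₁ (off-maximal uv not-maximal)

    ≈⇒maximal : twiceI F D ψ ≈ twiceI F D χ → AllArcsMaximal
    ≈⇒maximal ψ≈χ u v uv with maximalArc? u v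
    ... | yes maximal     = maximal
    ... | no  not-maximal = ⊥-elim (irrefl ψ≈χ (twiceI-mono-< {ψ} {χ} ψ≤χ uv (off-maximal uv not-maximal)))

    maximal⇒≈ : AllArcsMaximal → twiceI F D ψ ≈ twiceI F D χ
    maximal⇒≈ maximal = ≤-antisym (twiceI-mono-≤ {ψ} {χ} (λ uv → inj₂ (on-maximal (maximal _ _ uv))))
                                  (twiceI-mono-≤ {χ} {ψ} (λ uv → inj₂ (sym (on-maximal (maximal _ _ uv)))))

module Bounds {c ℓ₁ ℓ₂} (F : OrderedField c ℓ₁ ℓ₂) {n : ℕ} (2≤n : 2 N.≤ n)
  (D : Digraph n) (noIsolated : NoIsolated D) (φ : ℕ → ℕ → OrderedField.Carrier F)
  (φ-sym : ∀ i j → 1 N.≤ i → i N.≤ n N.∸ 1 → 1 N.≤ j → j N.≤ n N.∸ 1 → OrderedField._≈_ F (φ i j) (φ j i))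
  (0<φ* : OrderedField._<_ F (OrderedField.0# F) (φ (n N.∸ 1) (n N.∸ 1))) where

  open OrderedFieldProperties F
  open OrderedField F hiding (_<_; _≤F_)
  open Degrees D
  open ArcSums F D
  open Counting using (m<n⇒m≤n∸1)
  open import Data.Nat using (suc; _∸_)
  import Data.Nat.Properties as ℕ
  import Relation.Binary.PropositionalEquality as ≡
  open import Data.Product using (proj₁; proj₂)
  open import Function.Bundles using (mk⇔)
  open import Function.Related.Propositional using (module EquationalReasoning)
  open import Algebra.Solver.Ring.NaturalCoefficients.Default commutativeSemiring using (solve; _:+_; _:*_; _:=_)

  φ* two K bound : Carrier
  φ*    = φ (n ∸ 1) (n ∸ 1)
  two   = fromℕ 2
  K     = fromℕ (n ∸ 1) * φ*
  bound = fromℕ (n N.* (n ∸ 1)) * φ*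

  twiceM twoφ : DegreeFunction
  twiceM i j = (recip i + recip j) * K
  twoφ   i j = two * φ i j

  0<K : 0# < K
  0<K = *-pos (fromℕ-mono-< (m<n⇒m≤n∸1 2≤n)) 0<φ*

  bound≈nK : bound ≈ fromℕ n * K
  bound≈nK = trans (*-congʳ (fromℕ-* n (n ∸ 1))) (*-assoc _ _ _)

  twiceM-corner : twiceM (n ∸ 1) (n ∸ 1) ≈ two * φ*
  twiceM-corner = pair (m<n⇒m≤n∸1 2≤n)
    where
    open import Relation.Binary.Reasoning.Setoid setoid
    pair : ∀ {k} → 1 N.≤ k → (recip k + recip k) * (fromℕ k * φ*) ≈ two * φ*
    pair {suc k} _ = begin
      (recip (suc k) + recip (suc k)) * (fromℕ (suc k) * φ*)
        ≈⟨ solve 3 (λ r m p → (r :+ r) :* (m :* p) := (m :* r :+ m :* r) :* p) refl _ _ φ* ⟩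
      (fromℕ (suc k) * recip (suc k) + fromℕ (suc k) * recip (suc k)) * φ*
        ≈⟨ *-congʳ (+-cong (fromℕ*recip k) (trans (fromℕ*recip k) (sym (+-identityʳ 1#)))) ⟩
      two * φ* ∎

  -- The hypotheses compare 2ij·M_ij with 2ij·φ_ij; multiplying by (1/i)(1/j) removes the factor ij.
  scale-M : ∀ {i j} → 1 N.≤ i → 1 N.≤ j →
            fromℕ ((n ∸ 1) N.* (i N.+ j)) * φ* * (recip i * recip j) ≈ twiceM i j
  scale-M {suc i} {suc j} _ _ = begin
    fromℕ ((n ∸ 1) N.* (suc i N.+ suc j)) * φ* * (recip (suc i) * recip (suc j))
      ≈⟨ *-congʳ (*-congʳ (trans (fromℕ-* (n ∸ 1) _) (*-congˡ (fromℕ-+ (suc i) (suc j))))) ⟩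
    fromℕ (n ∸ 1) * (fromℕ (suc i) + fromℕ (suc j)) * φ* * (recip (suc i) * recip (suc j))
      ≈⟨ solve 6 (λ m x y p a b → m :* (x :+ y) :* p :* (a :* b) := (x :* a :* b :+ y :* b :* a) :* (m :* p))
               refl (fromℕ (n ∸ 1)) _ _ φ* _ _ ⟩
    (fromℕ (suc i) * recip (suc i) * recip (suc j) + fromℕ (suc j) * recip (suc j) * recip (suc i)) * K
      ≈⟨ *-congʳ (+-cong (cancel (fromℕ*recip i)) (cancel (fromℕ*recip j))) ⟩
    (recip (suc j) + recip (suc i)) * K
      ≈⟨ *-congʳ (+-comm _ _) ⟩
    twiceM (suc i) (suc j) ∎
    where
    open import Relation.Binary.Reasoning.Setoid setoid
    cancel : ∀ {x a b} → x * a ≈ 1# → x * a * b ≈ b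
    cancel xa≈1 = trans (*-congʳ xa≈1) (*-identityˡ _)

  scale-φ : ∀ {i j} ψ → 1 N.≤ i → 1 N.≤ j → fromℕ (2 N.* i N.* j) * ψ * (recip i * recip j) ≈ two * ψ
  scale-φ {suc i} {suc j} ψ _ _ = begin
    fromℕ (2 N.* suc i N.* suc j) * ψ * (recip (suc i) * recip (suc j))
      ≈⟨ *-congʳ (*-congʳ (trans (fromℕ-* (2 N.* suc i) (suc j)) (*-congʳ (fromℕ-* 2 (suc i))))) ⟩
    two * fromℕ (suc i) * fromℕ (suc j) * ψ * (recip (suc i) * recip (suc j))
      ≈⟨ solve 6 (λ t x y p a b → t :* x :* y :* p :* (a :* b) := t :* p :* (x :* a :* (y :* b)))
               refl two _ _ ψ _ _ ⟩
    two * ψ * (fromℕ (suc i) * recip (suc i) * (fromℕ (suc j) * recip (suc j)))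
      ≈⟨ *-congˡ (trans (*-cong (fromℕ*recip i) (fromℕ*recip j)) (*-identityʳ 1#)) ⟩
    two * ψ * 1#
      ≈⟨ *-identityʳ _ ⟩
    two * ψ ∎
    where open import Relation.Binary.Reasoning.Setoid setoid

  unscale-< : ∀ {i j x y x′ y′} → 1 N.≤ i → 1 N.≤ j →
              x * (recip i * recip j) ≈ x′ → y * (recip i * recip j) ≈ y′ → x < y → x′ < y′
  unscale-< {suc i} {suc j} _ _ x≈x′ y≈y′ x<y =
    <-respˡ-≈ x≈x′ (<-respʳ-≈ y≈y′ (*-monoʳ-< (*-pos (0<recip i) (0<recip j)) x<y))

  SymmetricOnRange : DegreeFunction → Set ℓ₁
  SymmetricOnRange ψ = ∀ i j → DegreeRange n i → DegreeRange n j → ψ i j ≈ ψ j i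

  twiceM-sym : SymmetricOnRange twiceM
  twiceM-sym i j _ _ = *-congʳ (+-comm (recip i) (recip j))

  twoφ-sym : SymmetricOnRange twoφ
  twoφ-sym i j (1≤i , i≤n-1) (1≤j , j≤n-1) = *-congˡ (φ-sym i j 1≤i i≤n-1 1≤j j≤n-1)

  off-corner-from-S₂ : ∀ {ψ χ} → SymmetricOnRange ψ → SymmetricOnRange χ → (∀ i j → InS₂ n i j → ψ i j < χ i j) →
                       ∀ i j → DegreeRange n i → DegreeRange n j → ¬ (i ≡ n ∸ 1 × j ≡ n ∸ 1) → ψ i j < χ i j
  off-corner-from-S₂ ψ-sym χ-sym on-S₂ i j i∈ j∈ not-corner with InS₂-or-swapped {n} i∈ j∈ not-corner
  ... | inj₁ ij∈S₂ = on-S₂ i j ij∈S₂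
  ... | inj₂ ji∈S₂ = <-respˡ-≈ (ψ-sym j i j∈ i∈) (<-respʳ-≈ (χ-sym j i j∈ i∈) (on-S₂ j i ji∈S₂))

  InS₂⇒positive : ∀ {i j} → InS₂ n i j → 1 N.≤ i × 1 N.≤ j
  InS₂⇒positive (1≤i , i≤j , _) = 1≤i , ℕ.≤-trans 1≤i i≤j

  twiceI-twiceM : twiceI F D twiceM ≈ fromℕ n₊ * K
  twiceI-twiceM = twiceI-recip K

  twiceI-twoφ : twiceI F D twoφ ≈ two * twiceI F D φ
  twiceI-twoφ = twiceI-*ˡ two φ

  bound≤twiceM : bound ≤F twiceI F D twiceM
  bound≤twiceM = begin
    bound                ≈⟨ bound≈nK ⟩
    fromℕ n * K          ≤⟨ *-monoʳ-≤ 0<K (fromℕ-mono-≤ (n≤n₊ noIsolated)) ⟩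
    fromℕ n₊ * K         ≈⟨ twiceI-twiceM ⟨
    twiceI F D twiceM    ∎
    where open ≤-Reasoning

  bound≈twiceM⇔n₀≡n : bound ≈ twiceI F D twiceM ⇔ n₀ D ≡ n
  bound≈twiceM⇔n₀≡n = begin
    bound ≈ twiceI F D twiceM        ∼⟨ ≈-resp₂-⇔ bound≈nK twiceI-twiceM ⟩
    fromℕ n * K ≈ fromℕ n₊ * K       ∼⟨ ⇔-sym (a≡b⇔fromℕa*x≈fromℕb*x 0<K) ⟩
    n ≡ n₊                           ∼⟨ n≡n₊⇔n₀≡n ⟩
    n₀ D ≡ n                         ∎
    where open EquationalReasoning

  twoBound≈ : two * bound ≈ fromℕ (n N.+ n) * K
  twoBound≈ = begin
    two * bound              ≈⟨ *-congˡ bound≈nK ⟩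
    two * (fromℕ n * K)      ≈⟨ *-assoc two (fromℕ n) K ⟨
    two * fromℕ n * K        ≈⟨ *-congʳ (fromℕ-* 2 n) ⟨
    fromℕ (2 N.* n) * K      ≡⟨ ≡.cong (λ m → fromℕ (n N.+ m) * K) (ℕ.+-identityʳ n) ⟩
    fromℕ (n N.+ n) * K      ∎
    where open import Relation.Binary.Reasoning.Setoid setoid

  twiceM≤twoBound : twiceI F D twiceM ≤F two * bound
  twiceM≤twoBound = begin
    twiceI F D twiceM    ≈⟨ twiceI-twiceM ⟩
    fromℕ n₊ * K         ≤⟨ *-monoʳ-≤ 0<K (fromℕ-mono-≤ n₊≤n+n) ⟩
    fromℕ (n N.+ n) * K  ≈⟨ twoBound≈ ⟨
    two * bound          ∎
    where open ≤-Reasoning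

  twiceM≈twoBound⇔n₀≡0 : twiceI F D twiceM ≈ two * bound ⇔ n₀ D ≡ 0
  twiceM≈twoBound⇔n₀≡0 = begin
    twiceI F D twiceM ≈ two * bound          ∼⟨ ≈-resp₂-⇔ twiceI-twiceM twoBound≈ ⟩
    fromℕ n₊ * K ≈ fromℕ (n N.+ n) * K       ∼⟨ ⇔-sym (a≡b⇔fromℕa*x≈fromℕb*x 0<K) ⟩
    n₊ ≡ n N.+ n                             ∼⟨ n₊≡n+n⇔n₀≡0 ⟩
    n₀ D ≡ 0                                 ∎
    where open EquationalReasoning

  lower-bound : (∀ i j → InS₂ n i j → fromℕ ((n ∸ 1) N.* (i N.+ j)) * φ* < fromℕ (2 N.* i N.* j) * φ i j) →
                bound ≤F two * twiceI F D φ × (bound ≈ two * twiceI F D φ ⇔ (n₀ D ≡ n × AllArcsMaximal))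
  lower-bound H = ≤-≤-sandwich bound≤twiceM (≤-respʳ-≈ twiceI-twoφ (proj₁ comparison)) bound≈twiceM⇔n₀≡n
                    (proj₂ comparison ⇔-∘ ≈-resp₂-⇔ refl (sym twiceI-twoφ))
    where
    twiceM<twoφ-on-S₂ : ∀ i j → InS₂ n i j → twiceM i j < twoφ i j
    twiceM<twoφ-on-S₂ i j ij∈S₂ =
      let 1≤i , 1≤j = InS₂⇒positive ij∈S₂
      in unscale-< 1≤i 1≤j (scale-M 1≤i 1≤j) (scale-φ (φ i j) 1≤i 1≤j) (H i j ij∈S₂)

    comparison : twiceI F D twiceM ≤F twiceI F D twoφ × (twiceI F D twiceM ≈ twiceI F D twoφ ⇔ AllArcsMaximal)
    comparison = twiceI-compare twiceM twoφ twiceM-corner (off-corner-from-S₂ twiceM-sym twoφ-sym twiceM<twoφ-on-S₂)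

  upper-bound : (∀ i j → InS₂ n i j → fromℕ (2 N.* i N.* j) * φ i j < fromℕ ((n ∸ 1) N.* (i N.+ j)) * φ*) →
                twiceI F D φ ≤F bound × (twiceI F D φ ≈ bound ⇔ (n₀ D ≡ 0 × AllArcsMaximal))
  upper-bound H = *-cancelˡ-≤ 0<two (proj₁ doubled) , equality
    where
    0<two : 0# < two
    0<two = 0<fromℕ[1+k] 1

    twoφ<twiceM-on-S₂ : ∀ i j → InS₂ n i j → twoφ i j < twiceM i j
    twoφ<twiceM-on-S₂ i j ij∈S₂ =
      let 1≤i , 1≤j = InS₂⇒positive ij∈S₂
      in unscale-< 1≤i 1≤j (scale-φ (φ i j) 1≤i 1≤j) (scale-M 1≤i 1≤j) (H i j ij∈S₂)

    comparison : twiceI F D twoφ ≤F twiceI F D twiceM × (twiceI F D twoφ ≈ twiceI F D twiceM ⇔ AllArcsMaximal)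
    comparison = twiceI-compare twoφ twiceM (sym twiceM-corner) (off-corner-from-S₂ twoφ-sym twiceM-sym twoφ<twiceM-on-S₂)

    doubled : two * twiceI F D φ ≤F two * bound × (two * twiceI F D φ ≈ two * bound ⇔ (AllArcsMaximal × n₀ D ≡ 0))
    doubled = ≤-≤-sandwich (≤-respˡ-≈ twiceI-twoφ (proj₁ comparison)) twiceM≤twoBound
                (proj₂ comparison ⇔-∘ ≈-resp₂-⇔ (sym twiceI-twoφ) refl) twiceM≈twoBound⇔n₀≡0

    equality : twiceI F D φ ≈ bound ⇔ (n₀ D ≡ 0 × AllArcsMaximal)
    equality = begin
      twiceI F D φ ≈ bound               ∼⟨ x≈y⇔z*x≈z*y 0<two ⟩
      two * twiceI F D φ ≈ two * bound   ∼⟨ proj₂ doubled ⟩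
      (AllArcsMaximal × n₀ D ≡ 0)        ∼⟨ mk⇔ swap swap ⟩
      (n₀ D ≡ 0 × AllArcsMaximal)        ∎
      where open EquationalReasoning

theorem2 : ∀ {c ℓ₁ ℓ₂} (F : OrderedField c ℓ₁ ℓ₂) →
    let open OrderedField F in
    (n : ℕ) → 2 N.≤ n → (D : Digraph n) → NoIsolated D →
    (φ : ℕ → ℕ → Carrier) →
    (∀ i j → 1 N.≤ i → i N.≤ n N.∸ 1 → 1 N.≤ j → j N.≤ n N.∸ 1 → φ i j ≈ φ j i) →
    0# < φ (n N.∸ 1) (n N.∸ 1) →
    -- (i)  φ_ij > M_ij on S₂  (M_ij = (n-1)/2 (1/i + 1/j) φ_{n-1,n-1}, multiplied by 2ij)
    ((∀ i j → InS₂ n i j →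
        (fromℕ ((n N.∸ 1) N.* (i N.+ j)) * φ (n N.∸ 1) (n N.∸ 1)) < (fromℕ (2 N.* i N.* j) * φ i j)) →
      -- I(D) ≥ ¼ n(n-1) φ_{n-1,n-1}   (multiplied by 4; 4 I(D) = 2 · twiceI)
      ((fromℕ (n N.* (n N.∸ 1)) * φ (n N.∸ 1) (n N.∸ 1)) ≤F (fromℕ 2 * twiceI F D φ))
      × (((fromℕ (n N.* (n N.∸ 1)) * φ (n N.∸ 1) (n N.∸ 1)) ≈ (fromℕ 2 * twiceI F D φ))
          ⇔ (n₀ D ≡ n × (∀ i j → InS₂ n i j → pC D i j ≡ 0)))
      × (((fromℕ (n N.* (n N.∸ 1)) * φ (n N.∸ 1) (n N.∸ 1)) ≈ (fromℕ 2 * twiceI F D φ))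
          ⇔ (D ≅ K⃗₂)))
    ×
    -- (ii) φ_ij < M_ij on S₂
    ((∀ i j → InS₂ n i j →
        (fromℕ (2 N.* i N.* j) * φ i j) < (fromℕ ((n N.∸ 1) N.* (i N.+ j)) * φ (n N.∸ 1) (n N.∸ 1))) →
      -- I(D) ≤ ½ n(n-1) φ_{n-1,n-1}   (multiplied by 2)
      (twiceI F D φ ≤F (fromℕ (n N.* (n N.∸ 1)) * φ (n N.∸ 1) (n N.∸ 1)))
      × ((twiceI F D φ ≈ (fromℕ (n N.* (n N.∸ 1)) * φ (n N.∸ 1) (n N.∸ 1)))
          ⇔ (n₀ D ≡ 0 × (∀ i j → InS₂ n i j → pC D i j ≡ 0)))
      × ((twiceI F D φ ≈ (fromℕ (n N.* (n N.∸ 1)) * φ (n N.∸ 1) (n N.∸ 1)))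
          ⇔ IsCompleteSymmetric D))
theorem2 F n 2≤n D noIsolated φ φ-sym 0<φ* =
  (λ H → let bound≤ , bound≈⇔ = lower-bound H
         in bound≤ , maximal⇔pC-S₂≡0 n ⇔-∘ bound≈⇔ , ⇔-sym (TwoVertices.≅K⃗₂⇔n₀≡n∧maximal D 2≤n noIsolated) ⇔-∘ bound≈⇔) ,
  (λ H → let ≤bound , ≈bound⇔ = upper-bound H
         in ≤bound , maximal⇔pC-S₂≡0 0 ⇔-∘ ≈bound⇔ , ⇔-sym (completeSymmetric⇔n₀≡0∧maximal 2≤n) ⇔-∘ ≈bound⇔)
  where
  open Bounds F 2≤n D noIsolated φ φ-sym 0<φ*
  open Degrees D using (AllArcsMaximal; pC-S₂≡0⇔AllArcsMaximal; completeSymmetric⇔n₀≡0∧maximal)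
  open import Data.Product.Function.NonDependent.Propositional using (_×-⇔_)
  open import Function.Construct.Identity using (⇔-id)

  maximal⇔pC-S₂≡0 : ∀ k → (n₀ D ≡ k × AllArcsMaximal) ⇔ (n₀ D ≡ k × (∀ i j → InS₂ n i j → pC D i j ≡ 0))
  maximal⇔pC-S₂≡0 k = ⇔-id _ ×-⇔ ⇔-sym pC-S₂≡0⇔AllArcsMaximal
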